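{- Let $n\ge3$, $m\ge1$, let $R$ be a dominant region of the $m$-Shi arrangement in $V_n$ with Shi tableau $T_R=(e_{ij})_{1\le i\le j\le n-1}$, and let $\tilde R$ be the dominant region of the $m$-Shi arrangement in $V_{n-1}$ whose Shi tableau is $(e_{ij})_{1\le i\le j\le n-2}$. Let $1\le i\le n-2$. Then $H_{\alpha_{i,n-2},m}$ (in $V_n$) is a separating wall for $R$ if and only if $H_{\alpha_{i,n-2},m}$ (in $V_{n-1}$) is a separating wall for $\tilde R$.
   Context: For $N\ge2$: let $e_1,\dots,e_N$ be the standard basis of $\mathbb R^N$ with standard inner product $\langle\cdot,\cdot\rangle$, $V_N=\{a\in\mathbb R^N:\sum a_i=0\}$, $\alpha_{ij}=e_i-e_{j+1}$ ($1\le i\le j\le N-1$), $\alpha_i=\alpha_{ii}$, $\theta=\alpha_{1,N-1}$, $H_{\alpha,k}=\{v\in V_N:\langle v,\alpha\rangle=k\}$. The $m$-Shi arrangement in $V_N$ is $\{H_{\alpha_{ij},k}:1\le i\le j\le N-1,\ -m<k\le m\}$; regions are connected components of the complement of the union of its hyperplanes; a region is dominant if contained in $\{v:\langle v,\alpha_i\rangle\ge0\ \forall i\}$. Alcoves are components of the complement of all $H_{\alpha_{ij},k}$, $k\in\mathbb Z$; the fundamental alcove $A_0$ is the interior of $\{v:\langle v,\theta\rangle\le1,\langle v,\alpha_i\rangle\ge0\ \forall i\}$. Each region contains a unique alcove separated from $A_0$ by the fewest hyperplanes $H_{\alpha,k}$ ($k\in\mathbb Z$), its $m$-minimal alcove.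 The Shi coordinates of an alcove $\mathcal A$ are the integers $k_{ij}$ with $k_{ij}<\langle x,\alpha_{ij}\rangle<k_{ij}+1$ for $x\in\mathcal A$. The Shi tableau of a region $R$ is $T_R=(e_{ij})_{1\le i\le j\le N-1}$ with $e_{ij}=\min(k_{ij},m)$ where $k_{ij}$ are the Shi coordinates of the $m$-minimal alcove of $R$; a dominant region is determined by its Shi tableau. A wall of a region $R$ is a hyperplane of the $m$-Shi arrangement supporting a facet of $R$; it is a separating wall if $R$ and $A_0$ lie in different closed half-spaces determined by it.
   Formalization: The spaces $V_n$ and $V_{n-1}$ are taken inside ℚ^n and ℚ^(n-1) rather than ℝ^N, so the points representing regions, minimal alcoves, walls and $A_0$ have rational coordinates. -}

module Defs where

open import Data.Nat using (ℕ; zero; suc; _∸_) renaming (_≤_ to _≤ℕ_; _+_ to _+ℕ_)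
open import Data.Integer using (ℤ; +_; ∣_∣; _⊓_) renaming (_≤_ to _≤ℤ_; _<_ to _<ℤ_; -_ to -ℤ_)
open import Data.Rational using (ℚ; 0ℚ; 1ℚ; _+_; _-_; _<_; floor) renaming (_/_ to _//_)
open import Data.Fin using (Fin) renaming (zero to fz; suc to fs)
open import Data.Product using (_×_; Σ; ∃; ∃-syntax; _,_)
open import Data.Sum using (_⊎_)
open import Data.Empty using (⊥)
open import Relation.Binary.PropositionalEquality using (_≡_; _≢_)
open import Function using (_∘_; _⇔_)

-- Points of ℚ^N are functions Fin N → ℚ.  (All hyperplanes are rational,
-- so regions/alcoves/facets are determined by their rational points.)
Pt : ℕ → Set
Pt N = Fin N → ℚ

ι : ℤ → ℚ
ι k = k // 1

sumPt : ∀ {N} → Pt N → ℚ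
sumPt {zero} x = 0ℚ
sumPt {suc N} x = x fz + sumPt (x ∘ fs)

InV : ∀ {N} → Pt N → Set
InV x = sumPt x ≡ 0ℚ

-- 0-indexed coordinate access (0 outside the range, never used there)
at : ∀ {N} → Pt N → ℕ → ℚ
at {zero} x k = 0ℚ
at {suc N} x zero = x fz
at {suc N} x (suc k) = at (x ∘ fs) k

-- ⟨x , α_ij⟩ = ⟨x , e_i - e_{j+1}⟩ = x_i - x_{j+1} (paper's 1-indexing)
ip : ∀ {N} → Pt N → ℕ → ℕ → ℚ
ip x i j = at x (i ∸ 1) - at x j

-- (i,j) indexes a positive root α_ij of V_N: 1 ≤ i ≤ j ≤ N-1
IsRoot : ℕ → ℕ → ℕ → Set
IsRoot N i j = (1 ≤ℕ i) × (i ≤ℕ j) × (j ≤ℕ N ∸ 1)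

InRange : ℕ → ℤ → Set
InRange m k = (-ℤ (+ m) <ℤ k) × (k ≤ℤ + m)

ShiHyp : ℕ → ℕ → ℕ → ℕ → ℤ → Set
ShiHyp N m i j k = IsRoot N i j × InRange m k

Generic : (N m : ℕ) → Pt N → Set
Generic N m x = ∀ i j k → ShiHyp N m i j k → ip x i j ≢ ι k

SameRegion : (N m : ℕ) → Pt N → Pt N → Set
SameRegion N m x y = ∀ i j k → ShiHyp N m i j k → (ip x i j < ι k ⇔ ip y i j < ι k)

-- the region of x is dominant: ⟨x,α_i⟩ > 0 (equivalently ≥ 0, as H_{α_i,0}
-- belongs to the arrangement and x is generic)
Dominant : (N : ℕ) → Pt N → Set
Dominant N x = ∀ i → IsRoot N i i → 0ℚ < ip x i i

AlcovePt : (N : ℕ) → Pt N → Set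
AlcovePt N y = ∀ i j (k : ℤ) → IsRoot N i j → ip y i j ≢ ι k

shiCoord : ∀ {N} → Pt N → ℕ → ℕ → ℤ
shiCoord y i j = floor (ip y i j)

sumI : (ℕ → ℕ) → ℕ → ℕ
sumI f zero = 0
sumI f (suc i) = sumI f i +ℕ f (suc i)

sumJ : (ℕ → ℕ → ℕ) → ℕ → ℕ
sumJ f zero = 0
sumJ f (suc j) = sumJ f j +ℕ sumI (λ i → f i (suc j)) (suc j)

-- number of hyperplanes H_{α,k} (k ∈ ℤ) separating the alcove of y from A_0:
-- for each root α_ij these are the k strictly between the Shi coordinates
-- 0 (of A_0) and k_ij, i.e. |k_ij| many
sepCount : (N : ℕ) → Pt N → ℕ
sepCount N y = sumJ (λ i j → ∣ shiCoord y i j ∣) (N ∸ 1)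

InMinimalAlcove : (N m : ℕ) → Pt N → Pt N → Set
InMinimalAlcove N m x y =
  InV y × AlcovePt N y × SameRegion N m x y ×
  (∀ z → InV z → AlcovePt N z → SameRegion N m x z → sepCount N y ≤ℕ sepCount N z)

IsShiTableau : (N m : ℕ) → Pt N → (ℕ → ℕ → ℤ) → Set
IsShiTableau N m x e =
  Σ (Pt N) λ y → (InMinimalAlcove N m x y × (∀ i j → IsRoot N i j → e i j ≡ shiCoord y i j ⊓ + m))

InA0 : (N : ℕ) → Pt N → Set
InA0 N a = InV a × ip a 1 (N ∸ 1) < 1ℚ × (∀ i → IsRoot N i i → 0ℚ < ip a i i)

-- H_{α_ij,k} supports a facet of the region of x: some point p of H lies on no
-- other hyperplane of the arrangement and on the same side as x of each of them
-- (so a relatively open piece of H lies in the closure of the region)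
IsWall : (N m : ℕ) → Pt N → ℕ → ℕ → ℤ → Set
IsWall N m x i j k =
  ShiHyp N m i j k ×
  Σ (Pt N) λ p → (InV p × ip p i j ≡ ι k ×
    (∀ i' j' k' → ShiHyp N m i' j' k' → ((i' ≡ i × j' ≡ j × k' ≡ k) → ⊥) →
       (ip p i' j' ≢ ι k') × (ip p i' j' < ι k' ⇔ ip x i' j' < ι k')))

-- the region of x and A_0 lie in different (closed) half-spaces of H_{α_ij,k}
-- (neither meets H, so this means opposite open sides)
Separates : (N : ℕ) → Pt N → ℕ → ℕ → ℤ → Set
Separates N x i j k =
  Σ (Pt N) λ a → (InA0 N a × ((ip a i j < ι k × ι k < ip x i j) ⊎ (ip x i j < ι k × ι k < ip a i j)))

IsSeparatingWall : (N m : ℕ) → Pt N → ℕ → ℕ → ℤ → Set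
IsSeparatingWall N m x i j k = IsWall N m x i j k × Separates N x i j k

{-# OPTIONS --safe #-}
-- The side of x on a hyperplane H_{α,k}, -m < k ≤ m, is read off min(k_α, m) at its m-minimal
-- alcove, so x and x̃ lie on the same side of every hyperplane of the arrangement in V_{n-1}.
-- Hence forgetting the last coordinate (and re-centring) takes a point of the facet of R on
-- H_{α_{i,n-2},m}, and a point of A_0, down to V_{n-1}.  Conversely a facet point p̃ for R̃ is
-- lifted by a last coordinate t putting each p̃_c - t into the same strip between hyperplanes
-- H_{α_{c+1,n-1},l} as x_c - x_{n-1}; these constraints on t are compatible because p̃ is on
-- x's side of each H_{α_{c+1,c'},K} comparing two such strips.  A_0 lies below every H_{α,m}.
module Submission where

open import Defs

module Walls where
  open import Data.Nat as ℕ using (ℕ; zero; suc; _∸_; z≤n; s≤s)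
  import Data.Nat.Properties as ℕP
  open import Data.Integer as ℤ using (ℤ; +_; 0ℤ; 1ℤ)
  import Data.Integer.Properties as ℤP
  import Data.Integer.DivMod as ℤD
  import Data.Integer.GCD as ℤG
  open import Data.Rational as ℚ using (ℚ; mkℚ; 0ℚ; 1ℚ; _+_; _-_; _*_; -_; 1/_; _<_; _≤_; _⊓_; _⊔_; floor; ↥_; ↧_)
  import Data.Rational.Properties as ℚP
  open import Data.Rational.Solver using (module +-*-Solver)
  open +-*-Solver
  open import Data.Fin using (inject₁) renaming (zero to fz; suc to fs)
  open import Data.Product as Product using (_×_; ∃-syntax; _,_; proj₁; proj₂)
  open import Data.Sum as Sum using (_⊎_; inj₁; inj₂)
  open import Data.Empty using (⊥; ⊥-elim)
  open import Relation.Nullary using (¬_; yes; no; Dec)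
  open import Relation.Binary.PropositionalEquality
  open import Relation.Binary.Definitions using (Tri; tri<; tri≈; tri>)
  open import Function using (_∘_; _⇔_; mk⇔; Equivalence)
  open import Function.Properties.Equivalence using () renaming (sym to ⇔-sym; trans to ⇔-trans)
  open Equivalence using (to; from)

  ↥-ι : ∀ k → ↥ (ι k) ≡ k
  ↥-ι k = trans (sym (ℤP.*-identityʳ _)) (trans (cong (↥ (ι k) ℤ.*_) (sym (ℤG.gcd-zeroʳ k))) (ℚP.↥-/ k 1))

  ↧-ι : ∀ k → ↧ (ι k) ≡ 1ℤ
  ↧-ι k = trans (sym (ℤP.*-identityʳ _)) (trans (cong (↧ (ι k) ℤ.*_) (sym (ℤG.gcd-zeroʳ k))) (ℚP.↧-/ k 1))

  *-↧-ι : ∀ a k → a ℤ.* ↧ (ι k) ≡ a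
  *-↧-ι a k = trans (cong (a ℤ.*_) (↧-ι k)) (ℤP.*-identityʳ a)

  ι-mono-< : ∀ {a b} → a ℤ.< b → ι a < ι b
  ι-mono-< {a} {b} a<b = ℚ.*<* (subst₂ ℤ._<_ (sym (trans (*-↧-ι _ b) (↥-ι a))) (sym (trans (*-↧-ι _ a) (↥-ι b))) a<b)

  ι-mono-≤ : ∀ {a b} → a ℤ.≤ b → ι a ≤ ι b
  ι-mono-≤ {a} {b} a≤b = ℚ.*≤* (subst₂ ℤ._≤_ (sym (trans (*-↧-ι _ b) (↥-ι a))) (sym (trans (*-↧-ι _ a) (↥-ι b))) a≤b)

  <-ι⇔ : ∀ {q k} → q < ι k ⇔ ↥ q ℤ.< k ℤ.* ↧ q
  <-ι⇔ {q} {k} = mk⇔ (λ { (ℚ.*<* h) → subst₂ ℤ._<_ (*-↧-ι (↥ q) k) (cong (ℤ._* ↧ q) (↥-ι k)) h })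
                     (λ h → ℚ.*<* (subst₂ ℤ._<_ (sym (*-↧-ι (↥ q) k)) (cong (ℤ._* ↧ q) (sym (↥-ι k))) h))

  ι-+ : ∀ a b → ι a + ι b ≡ ι (a ℤ.+ b)
  ι-+ a b with ι a | ↥-ι a | ↧-ι a | ι b | ↥-ι b | ↧-ι b
  ... | mkℚ n 0 _ | refl | refl | mkℚ n′ 0 _ | refl | refl =
    cong (ℚ._/ 1) (cong₂ ℤ._+_ (ℤP.*-identityʳ n) (ℤP.*-identityʳ n′))

  ι-neg : ∀ a → ι (ℤ.- a) ≡ - ι a
  ι-neg a = begin
      ι (ℤ.- a)
    ≡⟨ solve 2 (λ x y → x := (x :+ y) :- y) refl (ι (ℤ.- a)) (ι a) ⟩
      (ι (ℤ.- a) + ι a) - ι a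
    ≡⟨ cong (_- ι a) (ι-+ (ℤ.- a) a) ⟩
      ι (ℤ.- a ℤ.+ a) - ι a
    ≡⟨ cong (λ z → ι z - ι a) (ℤP.+-inverseˡ a) ⟩
      0ℚ - ι a
    ≡⟨ ℚP.+-identityˡ (- ι a) ⟩
      - ι a ∎
    where open ≡-Reasoning

  ι-minus : ∀ a b → ι (a ℤ.- b) ≡ ι a - ι b
  ι-minus a b = trans (sym (ι-+ a (ℤ.- b))) (cong (λ z → ι a + z) (ι-neg b))

  ι-suc : ∀ l → ι (+ suc l) ≡ ι (+ l) + 1ℚ
  ι-suc l = sym (trans (ι-+ (+ l) (+ 1)) (cong (ι ∘ +_) (ℕP.+-comm l 1)))

  floor*↧≤↥ : ∀ q → floor q ℤ.* ↧ q ℤ.≤ ↥ q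
  floor*↧≤↥ (mkℚ n d _) = ℤD.[n/d]*d≤n n (+ suc d)

  ↥<suc[floor]*↧ : ∀ q → ↥ q ℤ.< ℤ.suc (floor q) ℤ.* ↧ q
  ↥<suc[floor]*↧ (mkℚ n d _) =
    subst (λ z → n ℤ.< ℤ.suc z ℤ.* + suc d) (sym (ℤD.div-pos-is-/ℕ n (suc d))) (ℤD.n<s[n/ℕd]*d n (suc d))

  floor<⇔<ι : ∀ q k → floor q ℤ.< k ⇔ q < ι k
  floor<⇔<ι q@(mkℚ _ _ _) k = mk⇔ below floor<
    where
    below : floor q ℤ.< k → q < ι k
    below h = from (<-ι⇔ {q} {k})
      (ℤP.<-≤-trans (↥<suc[floor]*↧ q) (ℤP.*-monoʳ-≤-nonNeg (↧ q) {ℤ.suc (floor q)} {k} (ℤP.i<j⇒suc[i]≤j h)))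
    floor< : q < ι k → floor q ℤ.< k
    floor< h = ℤP.≰⇒> (λ k≤floor → ℤP.<⇒≱ (to (<-ι⇔ {q} {k}) h)
      (ℤP.≤-trans (ℤP.*-monoʳ-≤-nonNeg (↧ q) {k} {floor q} k≤floor) (floor*↧≤↥ q)))

  <ι⇔floor⊓< : ∀ {q k m} → k ℤ.≤ + m → q < ι k ⇔ floor q ℤ.⊓ + m ℤ.< k
  <ι⇔floor⊓< {q} {k} {m} k≤m = mk⇔ below⇒ ⇒below
    where
    below⇒ : q < ι k → floor q ℤ.⊓ + m ℤ.< k
    below⇒ h = ℤP.≤-<-trans (ℤP.i⊓j≤i (floor q) (+ m)) (from (floor<⇔<ι q k) h)
    ⇒below : floor q ℤ.⊓ + m ℤ.< k → q < ι k
    ⇒below h with ℤP.⊓-sel (floor q) (+ m)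
    ... | inj₁ min≡floor = to (floor<⇔<ι q k) (subst (ℤ._< k) min≡floor h)
    ... | inj₂ min≡m = ⊥-elim (ℤP.<⇒≱ (subst (ℤ._< k) min≡m h) k≤m)

  tableau-side : ∀ {N m x e a b k} → IsShiTableau N m x e → IsRoot N a b → InRange m k →
                 ip x a b < ι k ⇔ e a b ℤ.< k
  tableau-side {x = x} {a = a} {b} {k} (y , (_ , _ , sameRegion , _) , tableau) r rg =
    subst (λ z → ip x a b < ι k ⇔ z ℤ.< k) (sym (tableau a b r))
      (⇔-trans (sameRegion a b k (r , rg)) (<ι⇔floor⊓< (proj₂ rg)))

  neg<+ : ∀ {m l} → 1 ℕ.≤ m → ℤ.- (+ m) ℤ.< + l
  neg<+ (s≤s _) = ℤ.-<+

  inRange-+ : ∀ {m l} → 1 ℕ.≤ m → l ℕ.≤ m → InRange m (+ l)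
  inRange-+ 1≤m l≤m = neg<+ 1≤m , ℤ.+≤+ l≤m

  +-minus-inRange : ∀ {m a b} → 1 ℕ.≤ a → a ℕ.≤ m → b ℕ.≤ m → InRange m (+ a ℤ.- + b)
  +-minus-inRange {m} {suc a} {b} _ a≤m b≤m =
    subst (ℤ._< _) (ℤP.+-identityˡ (ℤ.- + m)) (ℤP.+-mono-<-≤ (ℤ.+<+ (s≤s z≤n)) (ℤP.neg-mono-≤ (ℤ.+≤+ b≤m))) ,
    ℤP.i≤j⇒i-k≤j (+ b) (ℤ.+≤+ a≤m)

  +-minus-suc< : ∀ {m a b} → a ℕ.≤ m → + a ℤ.- + suc b ℤ.< + m
  +-minus-suc< {m} {a} {b} a≤m =
    subst (+ a ℤ.- + suc b ℤ.<_) (ℤP.+-identityʳ (+ m))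
      (ℤP.+-mono-≤-< (ℤ.+≤+ a≤m) (ℤP.neg-mono-< {0ℤ} {+ suc b} (ℤ.+<+ (s≤s z≤n))))

  p<q⇒0<q-p : ∀ {p q} → p < q → 0ℚ < q - p
  p<q⇒0<q-p {p} {q} p<q = subst (_< q - p) (ℚP.+-inverseʳ p) (ℚP.+-monoˡ-< (- p) p<q)

  0<q-p⇒p<q : ∀ {p q} → 0ℚ < q - p → p < q
  0<q-p⇒p<q {p} {q} h = subst₂ _<_ (ℚP.+-identityˡ p) (solve 2 (λ p q → (q :- p) :+ p := q) refl p q) (ℚP.+-monoˡ-< p h)

  <-by-gap : ∀ {a b c d} → c < d → d - c ≡ b - a → a < b
  <-by-gap c<d gaps = 0<q-p⇒p<q (subst (0ℚ <_) gaps (p<q⇒0<q-p c<d))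

  sub-mono-< : ∀ {a b c d} → a < b → c < d → a - d < b - c
  sub-mono-< a<b c<d = ℚP.+-mono-< a<b (ℚP.neg-antimono-< c<d)

  sub-mono-≤ : ∀ {a b c d} → a ≤ b → c ≤ d → a - d ≤ b - c
  sub-mono-≤ a≤b c≤d = ℚP.+-mono-≤ a≤b (ℚP.neg-antimono-≤ c≤d)

  0<1 : 0ℚ < 1ℚ
  0<1 = ι-mono-< {0ℤ} {1ℤ} (ℤ.+<+ (s≤s z≤n))

  p-1<p : ∀ p → p - 1ℚ < p
  p-1<p p = <-by-gap 0<1 (solve 1 (λ p → con 1ℚ :- con 0ℚ := p :- (p :- con 1ℚ)) refl p)

  ≮∧≢⇒> : ∀ {u q} → ¬ u < q → u ≢ q → q < u
  ≮∧≢⇒> {u} {q} u≮q u≢q with ℚP.<-cmp u q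
  ... | tri< u<q _ _ = ⊥-elim (u≮q u<q)
  ... | tri≈ _ u≡q _ = ⊥-elim (u≢q u≡q)
  ... | tri> _ _ q<u = q<u

  sides-agree-above : ∀ {z w q} → z ≢ q → w ≢ q → (z < q ⇔ w < q) → (q < z ⇔ q < w)
  sides-agree-above z≢q w≢q below =
    mk⇔ (λ q<z → ≮∧≢⇒> (λ w<q → ℚP.<-asym q<z (from below w<q)) w≢q)
        (λ q<w → ≮∧≢⇒> (λ z<q → ℚP.<-asym q<w (to below z<q)) z≢q)

  snoc : ∀ {N} → Pt N → ℚ → Pt (suc N)
  snoc {zero} p t _ = t
  snoc {suc N} p t fz = p fz
  snoc {suc N} p t (fs c) = snoc (p ∘ fs) t c

  at-snoc : ∀ {N} (p : Pt N) t {k} → k ℕ.< N → at (snoc p t) k ≡ at p k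
  at-snoc {suc N} p t {zero} _ = refl
  at-snoc {suc N} p t {suc k} (s≤s k<N) = at-snoc (p ∘ fs) t k<N

  at-snoc-last : ∀ {N} (p : Pt N) t → at (snoc p t) N ≡ t
  at-snoc-last {zero} p t = refl
  at-snoc-last {suc N} p t = at-snoc-last (p ∘ fs) t

  init : ∀ {N} → Pt (suc N) → Pt N
  init p = p ∘ inject₁

  at-init : ∀ {N} (p : Pt (suc N)) {k} → k ℕ.< N → at (init p) k ≡ at p k
  at-init {suc N} p {zero} _ = refl
  at-init {suc N} p {suc k} (s≤s k<N) = at-init (p ∘ fs) k<N

  shift : ∀ {N} → ℚ → Pt N → Pt N
  shift δ p c = p c - δ

  at-shift : ∀ {N} δ (p : Pt N) {k} → k ℕ.< N → at (shift δ p) k ≡ at p k - δ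
  at-shift {suc N} δ p {zero} _ = refl
  at-shift {suc N} δ p {suc k} (s≤s k<N) = at-shift δ (p ∘ fs) k<N

  sum-shift : ∀ {N} δ (p : Pt N) → sumPt (shift δ p) ≡ sumPt p - ι (+ N) * δ
  sum-shift {zero} δ p = solve 1 (λ d → con 0ℚ := con 0ℚ :- con 0ℚ :* d) refl δ
  sum-shift {suc N} δ p = begin
      (p fz - δ) + sumPt (shift δ (p ∘ fs))
    ≡⟨ cong (λ z → (p fz - δ) + z) (sum-shift δ (p ∘ fs)) ⟩
      (p fz - δ) + (sumPt (p ∘ fs) - ι (+ N) * δ)
    ≡⟨ solve 4 (λ a s n d → (a :- d) :+ (s :- n :* d) := (a :+ s) :- (n :+ con 1ℚ) :* d) refl (p fz) (sumPt (p ∘ fs)) (ι (+ N)) δ ⟩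
      (p fz + sumPt (p ∘ fs)) - (ι (+ N) + 1ℚ) * δ
    ≡⟨ cong (λ z → (p fz + sumPt (p ∘ fs)) - z * δ) (sym (ι-suc N)) ⟩
      (p fz + sumPt (p ∘ fs)) - ι (+ suc N) * δ ∎
    where open ≡-Reasoning

  index<N : ∀ {N a b} → a ℕ.≤ b → b ℕ.< N → a ∸ 1 ℕ.< N
  index<N {a = a} a≤b b<N = ℕP.≤-<-trans (ℕP.m∸n≤m a 1) (ℕP.≤-<-trans a≤b b<N)

  ip-shift : ∀ {N} δ (p : Pt N) {a b} → a ℕ.≤ b → b ℕ.< N → ip (shift δ p) a b ≡ ip p a b
  ip-shift δ p {a} {b} a≤b b<N = trans (cong₂ _-_ (at-shift δ p (index<N a≤b b<N)) (at-shift δ p b<N))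
    (solve 3 (λ u v d → (u :- d) :- (v :- d) := u :- v) refl (at p (a ∸ 1)) (at p b) δ)

  0<ι[1+l] : ∀ l → 0ℚ < ι (+ suc l)
  0<ι[1+l] l = ι-mono-< {0ℤ} {+ suc l} (ℤ.+<+ (s≤s z≤n))

  mean : ∀ {N} → Pt (suc N) → ℚ
  mean {N} p = sumPt p * 1/_ (ι (+ suc N)) {{ℚ.>-nonZero (0<ι[1+l] N)}}

  centre : ∀ {N} → Pt (suc N) → Pt (suc N)
  centre p = shift (mean p) p

  centre-InV : ∀ {N} (p : Pt (suc N)) → InV (centre p)
  centre-InV {N} p = begin
      sumPt (shift (s * r) p)
    ≡⟨ sum-shift (s * r) p ⟩
      s - n * (s * r)
    ≡⟨ solve 3 (λ s n r → s :- n :* (s :* r) := s :- s :* (n :* r)) refl s n r ⟩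
      s - s * (n * r)
    ≡⟨ cong (λ z → s - s * z) (ℚP.*-inverseʳ n {{ℚ.>-nonZero (0<ι[1+l] N)}}) ⟩
      s - s * 1ℚ
    ≡⟨ solve 1 (λ s → s :- s :* con 1ℚ := con 0ℚ) refl s ⟩
      0ℚ ∎
    where
    open ≡-Reasoning
    s n r : ℚ
    s = sumPt p
    n = ι (+ suc N)
    r = 1/_ n {{ℚ.>-nonZero (0<ι[1+l] N)}}

  ip-centre : ∀ {N} (p : Pt (suc N)) {a b} → a ℕ.≤ b → b ℕ.< suc N → ip (centre p) a b ≡ ip p a b
  ip-centre p = ip-shift (mean p) p

  restrict : ∀ {N} → Pt (suc (suc N)) → Pt (suc N)
  restrict p = centre (init p)

  extend : ∀ {N} → Pt N → ℚ → Pt (suc N)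
  extend p t = centre (snoc p t)

  ip-restrict : ∀ {N} (p : Pt (suc (suc N))) {a b} → a ℕ.≤ b → b ℕ.< suc N → ip (restrict p) a b ≡ ip p a b
  ip-restrict p a≤b b<N = trans (ip-centre (init p) a≤b b<N) (cong₂ _-_ (at-init p (index<N a≤b b<N)) (at-init p b<N))

  ip-extend : ∀ {N} (p : Pt N) t {a b} → a ℕ.≤ b → b ℕ.< N → ip (extend p t) a b ≡ ip p a b
  ip-extend p t a≤b b<N =
    trans (ip-centre (snoc p t) a≤b (ℕP.m<n⇒m<1+n b<N)) (cong₂ _-_ (at-snoc p t (index<N a≤b b<N)) (at-snoc p t b<N))

  ip-extend-last : ∀ {N} (p : Pt N) t {c} → c ℕ.< N → ip (extend p t) (suc c) N ≡ at p c - t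
  ip-extend-last p t c<N = trans (ip-centre (snoc p t) c<N ℕP.≤-refl) (cong₂ _-_ (at-snoc p t c<N) (at-snoc-last p t))

  dominant-step : ∀ {N} {y : Pt N} → Dominant N y → ∀ {b} → suc b ℕ.≤ N ∸ 1 → at y (suc b) < at y b
  dominant-step dom {b} b+1≤ = 0<q-p⇒p<q (dom (suc b) (s≤s z≤n , ℕP.≤-refl , b+1≤))

  dominant-decreasing : ∀ {N} {y : Pt N} → Dominant N y → ∀ {a b} → a ℕ.< b → b ℕ.≤ N ∸ 1 → at y b < at y a
  dominant-decreasing {N} {y} dom {a} {suc b} a<b+1 b+1≤ with ℕP.m<1+n⇒m<n∨m≡n a<b+1
  ... | inj₁ a<b = ℚP.<-trans (dominant-step {N} {y} dom b+1≤) (dominant-decreasing {N} {y} dom a<b (ℕP.<⇒≤ b+1≤))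
  ... | inj₂ refl = dominant-step {N} {y} dom b+1≤

  dominant-nonincreasing : ∀ {N} {y : Pt N} → Dominant N y → ∀ {a b} → a ℕ.≤ b → b ℕ.≤ N ∸ 1 → at y b ≤ at y a
  dominant-nonincreasing {N} {y} dom a≤b b≤ with ℕP.m≤n⇒m<n∨m≡n a≤b
  ... | inj₁ a<b = ℚP.<⇒≤ (dominant-decreasing {N} {y} dom a<b b≤)
  ... | inj₂ refl = ℚP.≤-refl

  dominant-ip≤θ : ∀ {N} {y : Pt N} → Dominant N y → ∀ {i j} → IsRoot N i j → ip y i j ≤ ip y 1 (N ∸ 1)
  dominant-ip≤θ {N} {y} dom {i} (_ , i≤j , j≤) =
    sub-mono-≤ (dominant-nonincreasing {N} {y} dom z≤n (ℕP.≤-trans (ℕP.m∸n≤m i 1) (ℕP.≤-trans i≤j j≤)))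
               (dominant-nonincreasing {N} {y} dom j≤ ℕP.≤-refl)

  inA0⇒ip<1 : ∀ {N a i j} → InA0 N a → IsRoot N i j → ip a i j < 1ℚ
  inA0⇒ip<1 {N} {a} (_ , θ<1 , dom) r = ℚP.≤-<-trans (dominant-ip≤θ {N} {a} dom r) θ<1

  restrict-A0 : ∀ {N} {a : Pt (suc (suc N))} → 1 ℕ.≤ N → InA0 (suc (suc N)) a → InA0 (suc N) (restrict a)
  restrict-A0 {N} {a} 1≤N a∈A0@(_ , _ , dom) = centre-InV (init a) , θ<1 , dom′
    where
    θ<1 : ip (restrict a) 1 N < 1ℚ
    θ<1 = subst (_< 1ℚ) (sym (ip-restrict a 1≤N ℕP.≤-refl)) (inA0⇒ip<1 {a = a} a∈A0 (ℕP.≤-refl , 1≤N , ℕP.n≤1+n N))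
    dom′ : Dominant (suc N) (restrict a)
    dom′ i (1≤i , i≤i , i≤N) = subst (0ℚ <_) (sym (ip-restrict a i≤i (s≤s i≤N))) (dom i (1≤i , i≤i , ℕP.m≤n⇒m≤1+n i≤N))

  extend-A0-at : ∀ {N} {ã : Pt (suc N)} {s} → InA0 (suc N) ã → at ã 0 - 1ℚ < s → s < at ã N →
                 InA0 (suc (suc N)) (extend ã s)
  extend-A0-at {N} {ã} {s} (_ , _ , dom) lo<s s<hi = centre-InV (snoc ã s) , θ<1 , dom′
    where
    θ<1 : ip (extend ã s) 1 (suc N) < 1ℚ
    θ<1 = subst (_< 1ℚ) (sym (ip-extend-last ã s (s≤s z≤n)))
      (<-by-gap lo<s (solve 3 (λ u s o → s :- (u :- o) := o :- (u :- s)) refl (at ã 0) s 1ℚ))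
    dom′ : Dominant (suc (suc N)) (extend ã s)
    dom′ i (1≤i , _ , i≤N+1) = by-position (ℕP.m≤n⇒m<n∨m≡n i≤N+1)
      where
      by-position : i ℕ.< suc N ⊎ i ≡ suc N → 0ℚ < ip (extend ã s) i i
      by-position (inj₁ i≤N) = subst (0ℚ <_) (sym (ip-extend ã s ℕP.≤-refl i≤N)) (dom i (1≤i , ℕP.≤-refl , ℕP.≤-pred i≤N))
      by-position (inj₂ refl) = subst (0ℚ <_) (sym (ip-extend-last ã s (ℕP.n<1+n N))) (p<q⇒0<q-p s<hi)

  extend-A0 : ∀ {N} {ã : Pt (suc N)} → InA0 (suc N) ã → ∃[ a ] InA0 (suc (suc N)) a
  extend-A0 {N} {ã} ã∈A0@(_ , θ<1 , _) =
    let (s , lo<s , s<hi) = ℚP.<-dense room in extend ã s , extend-A0-at ã∈A0 lo<s s<hi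
    where
    room : at ã 0 - 1ℚ < at ã N
    room = <-by-gap θ<1 (solve 3 (λ u v o → o :- (u :- v) := v :- (u :- o)) refl (at ã 0) (at ã N) 1ℚ)

  separates⇒above : ∀ {N x i j k} → IsRoot N i j → 1ℤ ℤ.≤ k → Separates N x i j k → ι k < ip x i j
  separates⇒above r 1≤k (a , a∈A0 , inj₁ (_ , above)) = above
  separates⇒above {N} {k = k} r 1≤k (a , a∈A0 , inj₂ (_ , k<a)) =
    ⊥-elim (ℚP.<-asym k<a (ℚP.<-≤-trans (inA0⇒ip<1 {N} {a} a∈A0 r) (ι-mono-≤ {1ℤ} {k} 1≤k)))

  module Levels (threshold : ℕ → ℚ) where
    level : ℕ → ℚ → ℕ
    level zero d = 0
    level (suc l) d with threshold (suc l) ℚP.<? d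
    ... | yes _ = suc l
    ... | no _ = level l d

    level≤ : ∀ m d → level m d ℕ.≤ m
    level≤ zero d = z≤n
    level≤ (suc m) d with threshold (suc m) ℚP.<? d
    ... | yes _ = ℕP.≤-refl
    ... | no _ = ℕP.m≤n⇒m≤1+n (level≤ m d)

    level-below : ∀ m {d} → threshold 0 < d → threshold (level m d) < d
    level-below zero h = h
    level-below (suc m) {d} h with threshold (suc m) ℚP.<? d
    ... | yes below = below
    ... | no _ = level-below m h

    suc-level-not-below : ∀ m {d} → level m d ℕ.< m → ¬ threshold (suc (level m d)) < d
    suc-level-not-below (suc m) {d} l<m with threshold (suc m) ℚP.<? d
    ... | yes _ = ⊥-elim (ℕP.<-irrefl refl l<m)
    ... | no not-below with ℕP.m≤n⇒m<n∨m≡n (level≤ m d)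
    ...   | inj₁ l<m′ = suc-level-not-below m l<m′
    ...   | inj₂ l≡m = subst (λ l → ¬ threshold (suc l) < d) (sym l≡m) not-below

  open Levels (ι ∘ +_)

  InCell : ℕ → ℕ → ℚ → Set
  InCell m l u = ι (+ l) < u × (l ℕ.< m → u < ι (+ suc l))

  level-inCell : ∀ m {d} → 0ℚ < d → (level m d ℕ.< m → d ≢ ι (+ suc (level m d))) → InCell m (level m d) d
  level-inCell m 0<d generic =
    level-below m 0<d , λ l<m → ≮∧≢⇒> (suc-level-not-below m l<m) (≢-sym (generic l<m))

  inCell-sameSide : ∀ {m l u v k} → InCell m l u → InCell m l v → InRange m k → (u ≢ ι k) × (u < ι k ⇔ v < ι k)
  inCell-sameSide {m} {l} {u} {v} {k} (l<u , u<l+1) (l<v , v<l+1) (_ , k≤m) = by-level (k ℤP.≤? + l)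
    where
    by-level : Dec (k ℤ.≤ + l) → (u ≢ ι k) × (u < ι k ⇔ v < ι k)
    by-level (yes k≤l) = ≢-sym (ℚP.<⇒≢ k<u) , mk⇔ (⊥-elim ∘ ℚP.<-asym k<u) (⊥-elim ∘ ℚP.<-asym k<v)
      where
      k<u : ι k < u
      k<u = ℚP.≤-<-trans (ι-mono-≤ {k} {+ l} k≤l) l<u
      k<v : ι k < v
      k<v = ℚP.≤-<-trans (ι-mono-≤ {k} {+ l} k≤l) l<v
    by-level (no k≰l) = ℚP.<⇒≢ u<k , mk⇔ (λ _ → v<k) (λ _ → u<k)
      where
      l<k : + l ℤ.< k
      l<k = ℤP.≰⇒> k≰l
      l<m : l ℕ.< m
      l<m = ℤP.drop‿+<+ (ℤP.<-≤-trans l<k k≤m)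
      l+1≤k : ι (+ suc l) ≤ ι k
      l+1≤k = ι-mono-≤ {+ suc l} {k} (ℤP.i<j⇒suc[i]≤j l<k)
      u<k : u < ι k
      u<k = ℚP.<-≤-trans (u<l+1 l<m) l+1≤k
      v<k : v < ι k
      v<k = ℚP.<-≤-trans (v<l+1 l<m) l+1≤k

  minUpTo : (ℕ → ℚ) → ℕ → ℚ
  minUpTo f zero = f 0
  minUpTo f (suc K) = minUpTo f K ⊓ f (suc K)

  maxUpTo : (ℕ → ℚ) → ℕ → ℚ
  maxUpTo f zero = f 0
  maxUpTo f (suc K) = maxUpTo f K ⊔ f (suc K)

  minUpTo-≤ : ∀ f {K c} → c ℕ.≤ K → minUpTo f K ≤ f c
  minUpTo-≤ f {zero} z≤n = ℚP.≤-refl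
  minUpTo-≤ f {suc K} c≤K+1 with ℕP.m≤n⇒m<n∨m≡n c≤K+1
  ... | inj₁ c≤K = ℚP.≤-trans (ℚP.p⊓q≤p (minUpTo f K) (f (suc K))) (minUpTo-≤ f (ℕP.≤-pred c≤K))
  ... | inj₂ refl = ℚP.p⊓q≤q (minUpTo f K) (f (suc K))

  ≤-maxUpTo : ∀ f {K c} → c ℕ.≤ K → f c ≤ maxUpTo f K
  ≤-maxUpTo f {zero} z≤n = ℚP.≤-refl
  ≤-maxUpTo f {suc K} c≤K+1 with ℕP.m≤n⇒m<n∨m≡n c≤K+1
  ... | inj₁ c≤K = ℚP.≤-trans (≤-maxUpTo f (ℕP.≤-pred c≤K)) (ℚP.p≤p⊔q (maxUpTo f K) (f (suc K)))
  ... | inj₂ refl = ℚP.p≤q⊔p (maxUpTo f K) (f (suc K))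

  <-minUpTo : ∀ f {K v} → (∀ c → c ℕ.≤ K → v < f c) → v < minUpTo f K
  <-minUpTo f {zero} h = h 0 z≤n
  <-minUpTo f {suc K} {v} h with ℚP.⊓-sel (minUpTo f K) (f (suc K))
  ... | inj₁ eq = subst (v <_) (sym eq) (<-minUpTo f (λ c c≤K → h c (ℕP.m≤n⇒m≤1+n c≤K)))
  ... | inj₂ eq = subst (v <_) (sym eq) (h (suc K) ℕP.≤-refl)

  maxUpTo-< : ∀ f {K v} → (∀ c → c ℕ.≤ K → f c < v) → maxUpTo f K < v
  maxUpTo-< f {zero} h = h 0 z≤n
  maxUpTo-< f {suc K} {v} h with ℚP.⊔-sel (maxUpTo f K) (f (suc K))
  ... | inj₁ eq = subst (_< v) (sym eq) (maxUpTo-< f (λ c c≤K → h c (ℕP.m≤n⇒m≤1+n c≤K)))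
  ... | inj₂ eq = subst (_< v) (sym eq) (h (suc K) ℕP.≤-refl)

  interpolate : ∀ {P : ℕ → Set} → (∀ c → Dec (P c)) → (lo up : ℕ → ℚ) (K : ℕ) →
                (∀ c c′ → c ℕ.≤ K → c′ ℕ.≤ K → P c → lo c < up c′) →
                ∃[ t ] ((∀ c → c ℕ.≤ K → P c → lo c < t) × (∀ c → c ℕ.≤ K → t < up c))
  interpolate {P} P? lo up K lo<up =
    t , (λ c c≤K Pc → ℚP.≤-<-trans (lo≤lo′ c Pc) (ℚP.≤-<-trans (≤-maxUpTo lo′ c≤K) (proj₁ (proj₂ dense)))) ,
        (λ c c≤K → ℚP.<-≤-trans (proj₂ (proj₂ dense)) (minUpTo-≤ up c≤K))
    where
    B : ℚ
    B = minUpTo up K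
    lo′ : ℕ → ℚ
    lo′ c with P? c
    ... | yes _ = lo c
    ... | no _ = B - 1ℚ
    lo≤lo′ : ∀ c → P c → lo c ≤ lo′ c
    lo≤lo′ c Pc with P? c
    ... | yes _ = ℚP.≤-refl
    ... | no ¬Pc = ⊥-elim (¬Pc Pc)
    lo′<B : ∀ c → c ℕ.≤ K → lo′ c < B
    lo′<B c c≤K with P? c
    ... | yes Pc = <-minUpTo up (λ c′ c′≤K → lo<up c c′ c≤K c′≤K Pc)
    ... | no _ = p-1<p B
    dense : ∃[ t ] (maxUpTo lo′ K < t × t < B)
    dense = ℚP.<-dense (maxUpTo-< lo′ lo′<B)
    t : ℚ
    t = proj₁ dense

  SameSideOff : (N m : ℕ) → Pt N → Pt N → ℕ → ℕ → ℤ → Set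
  SameSideOff N m p x i j k =
    ∀ i′ j′ k′ → ShiHyp N m i′ j′ k′ → ((i′ ≡ i × j′ ≡ j × k′ ≡ k) → ⊥) →
      (ip p i′ j′ ≢ ι k′) × (ip p i′ j′ < ι k′ ⇔ ip x i′ j′ < ι k′)

  module ShiTableauPair (J m : ℕ) (1≤m : 1 ℕ.≤ m)
    (x : Pt (suc (suc J))) (x-generic : Generic (suc (suc J)) m x) (x-dominant : Dominant (suc (suc J)) x)
    (x̃ : Pt (suc J)) (x̃-generic : Generic (suc J) m x̃)
    (e : ℕ → ℕ → ℤ) (x-tableau : IsShiTableau (suc (suc J)) m x e) (x̃-tableau : IsShiTableau (suc J) m x̃ e) where

    root↑ : ∀ {a b} → IsRoot (suc J) a b → IsRoot (suc (suc J)) a b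
    root↑ (1≤a , a≤b , b≤J) = 1≤a , a≤b , ℕP.m≤n⇒m≤1+n b≤J

    x-decreasing : ∀ {a b} → a ℕ.< b → b ℕ.≤ suc J → at x b < at x a
    x-decreasing = dominant-decreasing {suc (suc J)} {x} x-dominant

    x<⇔x̃< : ∀ {a b k} → IsRoot (suc J) a b → InRange m k → ip x a b < ι k ⇔ ip x̃ a b < ι k
    x<⇔x̃< r rg = ⇔-trans (tableau-side x-tableau (root↑ r) rg) (⇔-sym (tableau-side x̃-tableau r rg))

    x>⇔x̃> : ∀ {a b k} → IsRoot (suc J) a b → InRange m k → ι k < ip x a b ⇔ ι k < ip x̃ a b
    x>⇔x̃> r rg = sides-agree-above (x-generic _ _ _ (root↑ r , rg)) (x̃-generic _ _ _ (r , rg)) (x<⇔x̃< r rg)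

    restrict-sameSideOff : ∀ {p i j k} → SameSideOff (suc (suc J)) m p x i j k → SameSideOff (suc J) m (restrict p) x̃ i j k
    restrict-sameSideOff {p} sides a b k (r@(_ , a≤b , b≤J) , rg) off
      = subst (λ z → (z ≢ ι k) × (z < ι k ⇔ ip x̃ a b < ι k)) (sym (ip-restrict p a≤b (s≤s b≤J)))
          (proj₁ side , ⇔-trans (proj₂ side) (x<⇔x̃< r rg))
      where
      side : (ip p a b ≢ ι k) × (ip p a b < ι k ⇔ ip x a b < ι k)
      side = sides a b k (root↑ r , rg) off

    restrict-wall : ∀ {i j k} → IsRoot (suc J) i j → IsWall (suc (suc J)) m x i j k → IsWall (suc J) m x̃ i j k
    restrict-wall r@(_ , i≤j , j≤J) ((_ , rg) , p , _ , p-on , sides) =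
      (r , rg) , restrict p , centre-InV (init p) , trans (ip-restrict p i≤j (s≤s j≤J)) p-on , restrict-sameSideOff sides

    restrict-separates : ∀ {i j k} → IsRoot (suc J) i j → InRange m k →
                         Separates (suc (suc J)) x i j k → Separates (suc J) x̃ i j k
    restrict-separates {i} {j} {k} r@(1≤i , i≤j , j≤J) rg (a , a∈A0 , sides) =
      restrict a , restrict-A0 (ℕP.≤-trans 1≤i (ℕP.≤-trans i≤j j≤J)) a∈A0 , sides′
      where
      sides′ : (ip (restrict a) i j < ι k × ι k < ip x̃ i j) ⊎ (ip x̃ i j < ι k × ι k < ip (restrict a) i j)
      sides′ = subst (λ z → (z < ι k × ι k < ip x̃ i j) ⊎ (ip x̃ i j < ι k × ι k < z)) (sym (ip-restrict a i≤j (s≤s j≤J)))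
        (Sum.map (Product.map₂ (to (x>⇔x̃> r rg))) (Product.map₁ (to (x<⇔x̃< r rg))) sides)

    restrict-separatingWall : ∀ {i j k} → IsRoot (suc J) i j →
                              IsSeparatingWall (suc (suc J)) m x i j k → IsSeparatingWall (suc J) m x̃ i j k
    restrict-separatingWall r (wall@((_ , rg) , _) , sep) = restrict-wall r wall , restrict-separates r rg sep

    extend-separates : ∀ {i j k} → IsRoot (suc J) i j → InRange m k → 1ℤ ℤ.≤ k →
                       Separates (suc J) x̃ i j k → Separates (suc (suc J)) x i j k
    extend-separates r rg 1≤k sep@(_ , ã∈A0 , _) =
      let (a , a∈A0) = extend-A0 ã∈A0 in
      a , a∈A0 , inj₁ (ℚP.<-≤-trans (inA0⇒ip<1 {a = a} a∈A0 (root↑ r)) (ι-mono-≤ 1≤k) ,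
                       from (x>⇔x̃> r rg) (separates⇒above r 1≤k sep))

    module WallExtension {i} (1≤i : 1 ℕ.≤ i) (i≤J : i ℕ.≤ J) (x-above : ι (+ m) < ip x i J)
      (p̃ : Pt (suc J)) (p̃-on : ip p̃ i J ≡ ι (+ m)) (p̃-sides : SameSideOff (suc J) m p̃ x̃ i J (+ m)) where

      p̃-below : ∀ {a b k} → ShiHyp (suc J) m a b k → ip x a b < ι k → ip p̃ a b < ι k
      p̃-below {a} {b} {k} (r , rg) below = from (proj₂ (p̃-sides a b k (r , rg) off-wall)) (to (x<⇔x̃< r rg) below)
        where
        off-wall : ¬ (a ≡ i × b ≡ J × k ≡ + m)
        off-wall (refl , refl , refl) = ℚP.<-asym below x-above

      p̃-above : ∀ {a b k} → ShiHyp (suc J) m a b k → k ≢ + m → ι k < ip x a b → ι k < ip p̃ a b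
      p̃-above {a} {b} {k} (r , rg) k≢m above =
        from (sides-agree-above (proj₁ side) (x̃-generic a b k (r , rg)) (proj₂ side)) (to (x>⇔x̃> r rg) above)
        where
        side : (ip p̃ a b ≢ ι k) × (ip p̃ a b < ι k ⇔ ip x̃ a b < ι k)
        side = p̃-sides a b k (r , rg) (k≢m ∘ proj₂ ∘ proj₂)

      gap : ℕ → ℚ
      gap c = ip x (suc c) (suc J)

      lvl : ℕ → ℕ
      lvl c = level m (gap c)

      gap-inCell : ∀ {c} → c ℕ.≤ J → InCell m (lvl c) (gap c)
      gap-inCell {c} c≤J =
        level-inCell m (p<q⇒0<q-p (x-decreasing (s≤s c≤J) ℕP.≤-refl))
          (λ l<m → x-generic (suc c) (suc J) _ ((s≤s z≤n , s≤s c≤J , ℕP.≤-refl) , inRange-+ 1≤m l<m))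

      -- p̃_c - t lies in the strip of gap c iff up c - 1 < t < up c (no lower bound when lvl c = m).
      up : ℕ → ℚ
      up c = at p̃ c - ι (+ lvl c)

      up-1<up-right : ∀ {c c′} → c′ ℕ.≤ J → lvl c ℕ.< m → c ℕ.< c′ → up c - 1ℚ < up c′
      up-1<up-right {c} {c′} c′≤J l<m c<c′ =
        <-by-gap p̃-below-K (trans (cong (λ z → (z - ι (+ lvl c′)) - (at p̃ c - at p̃ c′)) (ι-suc (lvl c)))
          (solve 4 (λ l l′ u u′ → ((l :+ con 1ℚ) :- l′) :- (u :- u′) := (u′ :- l′) :- ((u :- l) :- con 1ℚ)) refl
            (ι (+ lvl c)) (ι (+ lvl c′)) (at p̃ c) (at p̃ c′)))
        where
        c≤J : c ℕ.≤ J
        c≤J = ℕP.<⇒≤ (ℕP.<-≤-trans c<c′ c′≤J)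
        K : ℤ
        K = + suc (lvl c) ℤ.- + lvl c′
        x-below-K : ip x (suc c) c′ < ι K
        x-below-K = subst₂ _<_
          (solve 3 (λ u u′ v → (u :- v) :- (u′ :- v) := u :- u′) refl (at x c) (at x c′) (at x (suc J)))
          (sym (ι-minus (+ suc (lvl c)) (+ lvl c′)))
          (sub-mono-< (proj₂ (gap-inCell c≤J) l<m) (proj₁ (gap-inCell c′≤J)))
        p̃-below-K : at p̃ c - at p̃ c′ < ι (+ suc (lvl c)) - ι (+ lvl c′)
        p̃-below-K = subst (ip p̃ (suc c) c′ <_) (ι-minus (+ suc (lvl c)) (+ lvl c′))
          (p̃-below ((s≤s z≤n , c<c′ , c′≤J) , +-minus-inRange (s≤s z≤n) l<m (level≤ m (gap c′))) x-below-K)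

      up-1<up-left : ∀ {c c′} → c ℕ.≤ J → lvl c ℕ.< m → c′ ℕ.< c → up c - 1ℚ < up c′
      up-1<up-left {c} {c′} c≤J l<m c′<c =
        <-by-gap p̃-above-K (trans (cong (λ z → (at p̃ c′ - at p̃ c) - (ι (+ lvl c′) - z)) (ι-suc (lvl c)))
          (solve 4 (λ l l′ u u′ → (u′ :- u) :- (l′ :- (l :+ con 1ℚ)) := (u′ :- l′) :- ((u :- l) :- con 1ℚ)) refl
            (ι (+ lvl c)) (ι (+ lvl c′)) (at p̃ c) (at p̃ c′)))
        where
        c′≤J : c′ ℕ.≤ J
        c′≤J = ℕP.<⇒≤ (ℕP.<-≤-trans c′<c c≤J)
        root : IsRoot (suc J) (suc c′) c
        root = s≤s z≤n , c′<c , c≤J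
        K : ℤ
        K = + lvl c′ ℤ.- + suc (lvl c)
        K<m : K ℤ.< + m
        K<m = +-minus-suc< (level≤ m (gap c′))
        x-above-K : ι K < ip x (suc c′) c
        x-above-K = subst₂ _<_
          (sym (ι-minus (+ lvl c′) (+ suc (lvl c))))
          (solve 3 (λ u u′ v → (u′ :- v) :- (u :- v) := u′ :- u) refl (at x c) (at x c′) (at x (suc J)))
          (sub-mono-< (proj₁ (gap-inCell c′≤J)) (proj₂ (gap-inCell c≤J) l<m))
        x-above-0 : ι 0ℤ < ip x (suc c′) c
        x-above-0 = p<q⇒0<q-p (x-decreasing c′<c (ℕP.m≤n⇒m≤1+n c≤J))
        -- H_{α,K} need not belong to the arrangement (K ≤ -m); then H_{α,0} is used instead.
        p̃-above-ιK : Dec (K ℤ.< 0ℤ) → ι K < ip p̃ (suc c′) c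
        p̃-above-ιK (yes K<0) =
          ℚP.<-trans (ι-mono-< K<0) (p̃-above (root , inRange-+ 1≤m z≤n) (ℕP.<⇒≢ 1≤m ∘ ℤP.+-injective) x-above-0)
        p̃-above-ιK (no K≮0) =
          p̃-above (root , ℤP.<-≤-trans (neg<+ 1≤m) (ℤP.≮⇒≥ K≮0) , ℤP.<⇒≤ K<m) (ℤP.<⇒≢ K<m) x-above-K
        p̃-above-K : ι (+ lvl c′) - ι (+ suc (lvl c)) < at p̃ c′ - at p̃ c
        p̃-above-K = subst (_< ip p̃ (suc c′) c) (ι-minus (+ lvl c′) (+ suc (lvl c))) (p̃-above-ιK (K ℤP.<? 0ℤ))

      up-1<up : ∀ {c c′} → c ℕ.≤ J → c′ ℕ.≤ J → lvl c ℕ.< m → up c - 1ℚ < up c′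
      up-1<up {c} {c′} c≤J c′≤J l<m = by-order (ℕP.<-cmp c c′)
        where
        by-order : Tri (c ℕ.< c′) (c ≡ c′) (c′ ℕ.< c) → up c - 1ℚ < up c′
        by-order (tri< c<c′ _ _) = up-1<up-right c′≤J l<m c<c′
        by-order (tri≈ _ refl _) = p-1<p (up c)
        by-order (tri> _ _ c′<c) = up-1<up-left c≤J l<m c′<c

      last-coordinate : ∃[ t ] ((∀ c → c ℕ.≤ J → lvl c ℕ.< m → up c - 1ℚ < t) × (∀ c → c ℕ.≤ J → t < up c))
      last-coordinate = interpolate (λ c → lvl c ℕ.<? m) (λ c → up c - 1ℚ) up J (λ c c′ c≤J c′≤J → up-1<up c≤J c′≤J)

      module Lift (t : ℚ)
        (up-1<t : ∀ c → c ℕ.≤ J → lvl c ℕ.< m → up c - 1ℚ < t) (t<up : ∀ c → c ℕ.≤ J → t < up c) where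

        P : Pt (suc (suc J))
        P = extend p̃ t

        P-inCell : ∀ {c} → c ℕ.≤ J → InCell m (lvl c) (ip P (suc c) (suc J))
        P-inCell {c} c≤J = subst (InCell m (lvl c)) (sym (ip-extend-last p̃ t (s≤s c≤J))) (below-up , above-up-1)
          where
          below-up : ι (+ lvl c) < at p̃ c - t
          below-up = <-by-gap (t<up c c≤J) (solve 3 (λ u l t → (u :- l) :- t := (u :- t) :- l) refl (at p̃ c) (ι (+ lvl c)) t)
          above-up-1 : lvl c ℕ.< m → at p̃ c - t < ι (+ suc (lvl c))
          above-up-1 l<m = <-by-gap (up-1<t c c≤J l<m)
            (trans (solve 3 (λ u l t → t :- ((u :- l) :- con 1ℚ) := (l :+ con 1ℚ) :- (u :- t)) refl (at p̃ c) (ι (+ lvl c)) t)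
                   (cong (_- (at p̃ c - t)) (sym (ι-suc (lvl c)))))

        P-sameSide-last : ∀ {a k} → 1 ℕ.≤ a → a ℕ.≤ suc J → InRange m k →
                          (ip P a (suc J) ≢ ι k) × (ip P a (suc J) < ι k ⇔ ip x a (suc J) < ι k)
        P-sameSide-last {suc c} _ (s≤s c≤J) rg = inCell-sameSide (P-inCell c≤J) (gap-inCell c≤J) rg

        P-sameSideOff : SameSideOff (suc (suc J)) m P x i J (+ m)
        P-sameSideOff a b k ((1≤a , a≤b , b≤J+1) , rg) off = by-column (ℕP.m≤n⇒m<n∨m≡n b≤J+1)
          where
          by-column : b ℕ.< suc J ⊎ b ≡ suc J → (ip P a b ≢ ι k) × (ip P a b < ι k ⇔ ip x a b < ι k)
          by-column (inj₁ b≤J) = subst (λ z → (z ≢ ι k) × (z < ι k ⇔ ip x a b < ι k)) (sym (ip-extend p̃ t a≤b b≤J))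
                                   (proj₁ side , ⇔-trans (proj₂ side) (⇔-sym (x<⇔x̃< r rg)))
            where
            r : IsRoot (suc J) a b
            r = 1≤a , a≤b , ℕP.≤-pred b≤J
            side : (ip p̃ a b ≢ ι k) × (ip p̃ a b < ι k ⇔ ip x̃ a b < ι k)
            side = p̃-sides a b k (r , rg) off
          by-column (inj₂ refl) = P-sameSide-last 1≤a a≤b rg

        wall : IsWall (suc (suc J)) m x i J (+ m)
        wall = ((1≤i , i≤J , ℕP.n≤1+n J) , inRange-+ 1≤m ℕP.≤-refl) ,
               P , centre-InV (snoc p̃ t) , trans (ip-extend p̃ t i≤J ℕP.≤-refl) p̃-on , P-sameSideOff

      extended-wall : IsWall (suc (suc J)) m x i J (+ m)
      extended-wall = let (t , up-1<t , t<up) = last-coordinate in Lift.wall t up-1<t t<up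

    extend-separatingWall : ∀ {i} → 1 ℕ.≤ i → i ℕ.≤ J →
                            IsSeparatingWall (suc J) m x̃ i J (+ m) → IsSeparatingWall (suc (suc J)) m x i J (+ m)
    extend-separatingWall {i} 1≤i i≤J ((_ , p̃ , _ , p̃-on , p̃-sides) , sep) =
      WallExtension.extended-wall 1≤i i≤J x-above p̃ p̃-on p̃-sides , extend-separates r rg (ℤ.+≤+ 1≤m) sep
      where
      r : IsRoot (suc J) i J
      r = 1≤i , i≤J , ℕP.≤-refl
      rg : InRange m (+ m)
      rg = inRange-+ 1≤m ℕP.≤-refl
      x-above : ι (+ m) < ip x i J
      x-above = from (x>⇔x̃> r rg) (separates⇒above r (ℤ.+≤+ 1≤m) sep)

open import Data.Nat using (ℕ; _≤_; _∸_; zero; suc; s≤s)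
open import Data.Nat.Properties using (≤-refl)
open import Data.Integer using (ℤ; +_)
open import Data.Product using (_,_)
open import Function using (_⇔_; mk⇔)

lemma5p2 : (n m : ℕ) → 3 ≤ n → 1 ≤ m →
    (x : Pt n) → InV x → Generic n m x → Dominant n x →
    (x̃ : Pt (n ∸ 1)) → InV x̃ → Generic (n ∸ 1) m x̃ → Dominant (n ∸ 1) x̃ →
    (e : ℕ → ℕ → ℤ) → IsShiTableau n m x e → IsShiTableau (n ∸ 1) m x̃ e →
    (i : ℕ) → 1 ≤ i → i ≤ n ∸ 2 →
    (IsSeparatingWall n m x i (n ∸ 2) (+ m) ⇔ IsSeparatingWall (n ∸ 1) m x̃ i (n ∸ 2) (+ m))
lemma5p2 zero m ()
lemma5p2 (suc zero) m (s≤s ())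
lemma5p2 (suc (suc zero)) m (s≤s (s≤s ()))
lemma5p2 (suc (suc (suc J))) m _ 1≤m x _ x-generic x-dominant x̃ _ x̃-generic _ e x-tableau x̃-tableau i 1≤i i≤J =
  mk⇔ (restrict-separatingWall {i} {suc J} {+ m} (1≤i , i≤J , ≤-refl)) (extend-separatingWall {i} 1≤i i≤J)
  where
  open Walls.ShiTableauPair (suc J) m 1≤m x x-generic x-dominant x̃ x̃-generic e x-tableau x̃-tableau
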